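{- Let $n,m,j\in\mathbb{Z}^+$ with $n\geq 2$, $m\ge 3$, and $1\le j<\frac{m}{2}$, and let $G(m,j)$ be the generalized Petersen graph. If $n\notin\{2,4\}$, then $\chi_n(G(m,j)) = \chi(G(m,j))$. If $n\in\{2,4\}$, $2\mid m$ and $2\nmid j$, then $\chi_n(G(m,j)) = \chi(G(m,j))=2$. If $n\in\{2,4\}$ and it is not the case that ($2\mid m$ and $2\nmid j$), then $3 \leq \chi_n(G(m,j)) \leq 6$.
   Context: $G(m,j)$ has vertex set $\{v_i,u_i : 0\le i<m\}$ and edges $v_iv_{i+1}$, $v_iu_i$, $u_iu_{i+j}$ for $0\le i<m$, indices mod $m$. For a graph $G=(V,E)$, a $\mathbb{Z}$-labeling is a map $\ell:V\to\mathbb{Z}$; its order is the size of its range; it is proper if adjacent vertices get different labels; $\chi(G)$ is the minimum order of a proper labeling. $N[v]$ is the closed neighborhood of $v$. A closed coloring with nonzero remainders mod $n$ is a labeling with $\sum_{w\in N[v]}\ell(w)\not\equiv 0 \pmod n$ for all $v\in V$. $\chi_n(G)$ denotes the minimum order of a proper closed coloring with nonzero remainders mod $n$ of $G$. -}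

module Defs where

open import Data.Nat as ℕ using (ℕ; _≡ᵇ_; NonZero)
open import Data.Nat.DivMod using (_%_)
open import Data.Fin using (Fin; toℕ)
open import Data.Fin.Properties using () renaming (_≟_ to _≟F_)
open import Data.Integer as ℤ using (ℤ; +_)
open import Data.Integer.Divisibility using () renaming (_∣_ to _∣ℤ_)
open import Data.List using (List; map; _++_; length; deduplicate; filterᵇ; foldr; allFin)
open import Data.Bool using (Bool; true; false; _∨_)
open import Data.Product using (Σ; _×_; _,_)
open import Relation.Nullary using (¬_; isYes)
open import Relation.Binary using (DecidableEquality)
open import Relation.Binary.PropositionalEquality using (_≡_; _≢_; refl)

-- A finite simple graph given by an enumeration of its vertices (each exactly once),
-- decidable equality on vertices, and a Boolean adjacency relation.
record FinGraph : Set₁ where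
  field
    V        : Set
    vertices : List V
    _≟V_     : DecidableEquality V
    adj      : V → V → Bool

module _ (G : FinGraph) where
  open FinGraph G

  Labeling : Set
  Labeling = V → ℤ

  order : Labeling → ℕ
  order ℓ = length (deduplicate ℤ._≟_ (map ℓ vertices))

  Proper : Labeling → Set
  Proper ℓ = ∀ x y → adj x y ≡ true → ℓ x ≢ ℓ y

  closedNbhd : V → List V
  closedNbhd x = filterᵇ (λ w → isYes (w ≟V x) ∨ adj x w) vertices

  closedSum : Labeling → V → ℤ
  closedSum ℓ x = foldr ℤ._+_ (+ 0) (map ℓ (closedNbhd x))

  ClosedColoringMod : ℕ → Labeling → Set
  ClosedColoringMod n ℓ = ∀ x → ¬ ((+ n) ∣ℤ closedSum ℓ x)

  IsChromatic : ℕ → Set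
  IsChromatic k = Σ Labeling (λ ℓ → Proper ℓ × order ℓ ≡ k)
                × (∀ ℓ → Proper ℓ → k ℕ.≤ order ℓ)

  IsChiMod : ℕ → ℕ → Set
  IsChiMod n k = Σ Labeling (λ ℓ → Proper ℓ × ClosedColoringMod n ℓ × order ℓ ≡ k)
               × (∀ ℓ → Proper ℓ → ClosedColoringMod n ℓ → k ℕ.≤ order ℓ)

data PVtx (m : ℕ) : Set where
  v : Fin m → PVtx m
  u : Fin m → PVtx m

PVtx-≟ : ∀ {m} → DecidableEquality (PVtx m)
PVtx-≟ (v i) (v k) with i ≟F k
... | Relation.Nullary.yes refl = Relation.Nullary.yes refl
... | Relation.Nullary.no ne = Relation.Nullary.no (λ { refl → ne refl })
PVtx-≟ (v i) (u k) = Relation.Nullary.no (λ ())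
PVtx-≟ (u i) (v k) = Relation.Nullary.no (λ ())
PVtx-≟ (u i) (u k) with i ≟F k
... | Relation.Nullary.yes refl = Relation.Nullary.yes refl
... | Relation.Nullary.no ne = Relation.Nullary.no (λ { refl → ne refl })

module _ (m j : ℕ) .{{_ : NonZero m}} where
  shiftIs : Fin m → ℕ → Fin m → Bool
  shiftIs i d k = toℕ k ≡ᵇ ((toℕ i ℕ.+ d) % m)

  petersenAdj : PVtx m → PVtx m → Bool
  petersenAdj (v i) (v k) = shiftIs i 1 k ∨ shiftIs k 1 i
  petersenAdj (v i) (u k) = isYes (i ≟F k)
  petersenAdj (u i) (v k) = isYes (i ≟F k)
  petersenAdj (u i) (u k) = shiftIs i j k ∨ shiftIs k j i

  GP : FinGraph
  GP = record
    { V = PVtx m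
    ; vertices = map v (allFin m) ++ map u (allFin m)
    ; _≟V_ = PVtx-≟
    ; adj = petersenAdj
    }

{-# OPTIONS --safe #-}
-- Every closed neighbourhood of G(m,j) consists of a vertex, its two neighbours on the same
-- rim and its spoke neighbour. If ℓ is a proper labeling of minimum order χ, then 1 + nℓ is
-- proper of the same order and all its closed sums are ≡ 4 (mod n); so χₙ = χ unless n ∣ 4.
-- For n ∈ {2, 4} it suffices that every closed sum is odd. If G(m,j) is bipartite (m even,
-- j odd) the 0/1 labeling by parity achieves this with two labels. Otherwise G(m,j) has an odd
-- cycle, so χₙ ≥ 3, while odd labels on the outer cycle and even labels on the inner cycles,
-- each properly 3-colored, give odd closed sums with at most 6 labels.
-- Minimum orders exist because every labeling can be replaced by one with values below
-- order · n that has the same color classes and the same residues mod n, so whether some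
-- labeling of order k has the required properties is decided by a finite search.
module Submission where

open import Defs
open import Data.Nat as ℕ using (ℕ; NonZero)
open import Data.Nat.Divisibility using (_∣_)
open import Relation.Nullary using (Dec; ¬_)

module IntegerSums where
  open import Data.Bool using (Bool; true; false; if_then_else_)
  open import Data.Integer using (ℤ; 0ℤ; _+_; _*_)
  open import Data.Integer.Properties using (+-identityˡ; *-zeroʳ)
  open import Data.Integer.Tactic.RingSolver using (solve-∀)
  open import Data.List using (List; []; _∷_; map; foldr; filterᵇ)
  open import Data.List.Membership.Propositional using (_∈_; _∉_)
  open import Data.List.Properties using (map-cong-local)
  open import Data.List.Relation.Binary.Subset.Propositional using (_⊆_)
  open import Data.List.Relation.Unary.All as All using (All; []; _∷_)
  open import Data.List.Relation.Unary.Any using (here; there)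
  open import Data.List.Relation.Unary.Unique.Propositional using (Unique; _∷_)
  open import Relation.Binary using (DecidableEquality)
  open import Relation.Binary.PropositionalEquality
  open import Relation.Nullary using (yes; no; does; contradiction)
  open import Function using (_∘_)

  sumℤ : List ℤ → ℤ
  sumℤ = foldr _+_ 0ℤ

  module _ {A : Set} where

    sumℤ-filterᵇ : (p : A → Bool) (f : A → ℤ) (xs : List A) →
      sumℤ (map f (filterᵇ p xs)) ≡ sumℤ (map (λ x → if p x then f x else 0ℤ) xs)
    sumℤ-filterᵇ p f [] = refl
    sumℤ-filterᵇ p f (x ∷ xs) with p x
    ... | true = cong (f x +_) (sumℤ-filterᵇ p f xs)
    ... | false = trans (sumℤ-filterᵇ p f xs) (sym (+-identityˡ _))

    sumℤ-linear : (f g : A → ℤ) (c : ℤ) (xs : List A) →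
      sumℤ (map (λ x → f x + c * g x) xs) ≡ sumℤ (map f xs) + c * sumℤ (map g xs)
    sumℤ-linear f g c [] = sym (trans (+-identityˡ _) (*-zeroʳ c))
    sumℤ-linear f g c (x ∷ xs) = begin
      f x + c * g x + sumℤ (map (λ x → f x + c * g x) xs)
        ≡⟨ cong (f x + c * g x +_) (sumℤ-linear f g c xs) ⟩
      f x + c * g x + (sumℤ (map f xs) + c * sumℤ (map g xs))
        ≡⟨ rearrange (f x) (g x) (sumℤ (map f xs)) (sumℤ (map g xs)) c ⟩
      f x + sumℤ (map f xs) + c * (g x + sumℤ (map g xs)) ∎
      where
      open ≡-Reasoning
      rearrange : ∀ a b s t c → a + c * b + (s + c * t) ≡ a + s + c * (b + t)
      rearrange = solve-∀

    sumℤ-zero : (f : A → ℤ) (xs : List A) → (∀ x → f x ≡ 0ℤ) → sumℤ (map f xs) ≡ 0ℤ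
    sumℤ-zero f [] f≡0 = refl
    sumℤ-zero f (x ∷ xs) f≡0 = cong₂ _+_ (f≡0 x) (sumℤ-zero f xs f≡0)

  module _ {A : Set} (_≟_ : DecidableEquality A) where

    _without_ : (A → ℤ) → A → A → ℤ
    (f without a) x = if does (x ≟ a) then 0ℤ else f x

    without-≢ : ∀ f {a x} → a ≢ x → (f without a) x ≡ f x
    without-≢ f {a} {x} a≢x with x ≟ a
    ... | yes x≡a = contradiction (sym x≡a) a≢x
    ... | no _ = refl

    without-≡ : ∀ f a → (f without a) a ≡ 0ℤ
    without-≡ f a with a ≟ a
    ... | yes _ = refl
    ... | no a≢a = contradiction refl a≢a

    sumℤ-pick : ∀ f {a xs} → Unique xs → a ∈ xs →
      sumℤ (map f xs) ≡ f a + sumℤ (map (f without a) xs)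
    sumℤ-pick f {a} {_ ∷ xs} (a∉xs ∷ _) (here refl) = cong (f a +_) (begin
      sumℤ (map f xs)                                ≡⟨ cong sumℤ (map-cong-local agree) ⟩
      sumℤ (map (f without a) xs)                    ≡⟨ +-identityˡ _ ⟨
      0ℤ + sumℤ (map (f without a) xs)               ≡⟨ cong (_+ sumℤ (map (f without a) xs)) (without-≡ f a) ⟨
      (f without a) a + sumℤ (map (f without a) xs) ∎)
      where
      open ≡-Reasoning
      agree : All (λ x → f x ≡ (f without a) x) xs
      agree = All.map (λ a≢x → sym (without-≢ f a≢x)) a∉xs
    sumℤ-pick f {a} {x ∷ xs} (x∉xs ∷ xs!) (there a∈xs) = begin
      f x + sumℤ (map f xs)                           ≡⟨ cong (f x +_) (sumℤ-pick f xs! a∈xs) ⟩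
      f x + (f a + sumℤ (map (f without a) xs))       ≡⟨ swap (f x) (f a) _ ⟩
      f a + (f x + sumℤ (map (f without a) xs))       ≡⟨ cong (λ y → f a + (y + _)) (without-≢ f a≢x) ⟨
      f a + ((f without a) x + sumℤ (map (f without a) xs)) ∎
      where
      open ≡-Reasoning
      a≢x : a ≢ x
      a≢x a≡x = All.lookup x∉xs a∈xs (sym a≡x)
      swap : ∀ x y z → x + (y + z) ≡ y + (x + z)
      swap = solve-∀

    sumℤ-support : ∀ f {xs} S → Unique xs → Unique S → S ⊆ xs → (∀ x → x ∉ S → f x ≡ 0ℤ) →
      sumℤ (map f xs) ≡ sumℤ (map f S)
    sumℤ-support f {xs} [] _ _ _ vanish = sumℤ-zero f xs (λ x → vanish x λ ())
    sumℤ-support f {xs} (a ∷ S) xs! (a∉S ∷ S!) S⊆xs vanish = begin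
      sumℤ (map f xs)                   ≡⟨ sumℤ-pick f xs! (S⊆xs (here refl)) ⟩
      f a + sumℤ (map (f without a) xs)
        ≡⟨ cong (f a +_) (sumℤ-support (f without a) S xs! S! (S⊆xs ∘ there) vanish′) ⟩
      f a + sumℤ (map (f without a) S)
        ≡⟨ cong (λ ys → f a + sumℤ ys) (map-cong-local (All.map (without-≢ f) a∉S)) ⟩
      f a + sumℤ (map f S)              ∎
      where
      open ≡-Reasoning
      vanish′ : ∀ x → x ∉ S → (f without a) x ≡ 0ℤ
      vanish′ x x∉S with x ≟ a
      ... | yes _ = refl
      ... | no x≢a = vanish x λ { (here x≡a) → x≢a x≡a ; (there x∈S) → x∉S x∈S }

module IntegerDivisibility where
  open import Data.Integer using (ℤ; +_; 1ℤ; _+_; _*_)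
  open import Data.Integer.Divisibility using () renaming (_∣_ to _∣ℤ_)
  import Data.Integer.Divisibility.Signed as Signed
  open import Data.Integer.Tactic.RingSolver using (solve-∀)
  open import Data.Nat.Divisibility using (∣⇒≤; ∣-trans)
  open import Data.Nat.Properties using (<-irrefl)
  open import Data.Product using (∃; _,_)
  open import Relation.Binary.PropositionalEquality using (_≡_; refl)
  open import Relation.Nullary using (¬_)

  Odd : ℤ → Set
  Odd z = ∃ λ t → z ≡ 1ℤ + + 2 * t

  odd+even : ∀ {a} b → Odd a → Odd (a + + 2 * b)
  odd+even b (t , refl) = t + b , rearrange t b
    where
    rearrange : ∀ t b → 1ℤ + + 2 * t + + 2 * b ≡ 1ℤ + + 2 * (t + b)
    rearrange = solve-∀

  ∣m+n*o⇒∣m : ∀ {n m o} → + n ∣ℤ m + + n * o → + n ∣ℤ m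
  ∣m+n*o⇒∣m {n} {m} {o} n∣m+no =
    Signed.∣⇒∣ᵤ {+ n} {m} (Signed.∣m+n∣n⇒∣m (Signed.∣ᵤ⇒∣ {+ n} {m + + n * o} n∣m+no)
                                           (Signed.∣m⇒∣m*n o (Signed.∣-refl {+ n})))

  2∣n⇒∤odd : ∀ {n z} → 2 ∣ n → Odd z → ¬ (+ n ∣ℤ z)
  2∣n⇒∤odd 2∣n (t , refl) n∣z = <-irrefl refl (∣⇒≤ (∣m+n*o⇒∣m {2} {1ℤ} {t} (∣-trans 2∣n n∣z)))

module UniqueLists where
  open import Data.List using (List; []; _∷_; map; length)
  open import Data.List.Membership.Propositional using (_∈_)
  open import Data.List.Properties using (length-removeAt′)
  open import Data.List.Relation.Binary.Subset.Propositional using (_⊆_)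
  open import Data.List.Relation.Unary.All as All using (All; []; _∷_)
  open import Data.List.Relation.Unary.All.Properties as All using ()
  open import Data.List.Relation.Unary.Any using (here; there; index; _─_)
  open import Data.List.Relation.Unary.Unique.Propositional using (Unique; []; _∷_)
  open import Data.Nat using (_≤_; z≤n; s≤s)
  open import Data.Nat.Properties using (≤-reflexive; ≤-trans)
  open import Relation.Binary.PropositionalEquality
  open import Relation.Nullary using (contradiction)

  module _ {A : Set} where

    ∈-─ : ∀ {x y : A} {ys} (x∈ys : x ∈ ys) → y ∈ ys → x ≢ y → y ∈ (ys ─ x∈ys)
    ∈-─ (here refl) (here refl) x≢y = contradiction refl x≢y
    ∈-─ (here refl) (there y∈ys) _ = y∈ys
    ∈-─ (there x∈ys) (here refl) _ = here refl
    ∈-─ (there x∈ys) (there y∈ys) x≢y = there (∈-─ x∈ys y∈ys x≢y)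

    Unique⇒length≤ : ∀ {xs ys : List A} → Unique xs → xs ⊆ ys → length xs ≤ length ys
    Unique⇒length≤ {[]} _ _ = z≤n
    Unique⇒length≤ {x ∷ xs} {ys} (x∉xs ∷ xs!) x∷xs⊆ys =
      ≤-trans (s≤s (Unique⇒length≤ xs! xs⊆ys─x)) (≤-reflexive (sym (length-removeAt′ ys (index x∈ys))))
      where
      x∈ys = x∷xs⊆ys (here refl)
      xs⊆ys─x : xs ⊆ (ys ─ x∈ys)
      xs⊆ys─x z∈xs = ∈-─ x∈ys (x∷xs⊆ys (there z∈xs)) (All.lookup x∉xs z∈xs)

  module _ {A B : Set} where

    map⁺-local : ∀ {f : A → B} {xs} → (∀ {x y} → x ∈ xs → y ∈ xs → f x ≡ f y → x ≡ y) →
      Unique xs → Unique (map f xs)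
    map⁺-local inj [] = []
    map⁺-local {f} {x ∷ xs} inj (x∉xs ∷ xs!) =
      All.map⁺ (All.tabulate λ y∈xs fx≡fy → All.lookup x∉xs y∈xs (inj (here refl) (there y∈xs) fx≡fy))
      ∷ map⁺-local (λ x∈ y∈ → inj (there x∈) (there y∈)) xs!

module LeastNumber where
  open import Data.Nat using (ℕ; _≤_; _<_)
  open import Data.Nat.Induction using (<-rec)
  open import Data.Nat.Properties using (anyUpTo?; ≮⇒≥)
  open import Data.Product using (∃; _×_; _,_)
  open import Relation.Nullary using (Dec; yes; no)

  Least : (ℕ → Set) → ℕ → Set
  Least Q k = Q k × (∀ k′ → Q k′ → k ≤ k′)

  least : {Q : ℕ → Set} → (∀ k → Dec (Q k)) → ∀ {K} → Q K → ∃ (Least Q)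
  least {Q} Q? {K} = <-rec (λ K → Q K → ∃ (Least Q)) step K
    where
    step : ∀ K → (∀ {k} → k < K → Q k → ∃ (Least Q)) → Q K → ∃ (Least Q)
    step K below qK with anyUpTo? Q? K
    ... | yes (k , k<K , qk) = below k<K qk
    ... | no nothing-below = K , qK , λ k′ qk′ → ≮⇒≥ λ k′<K → nothing-below (k′ , k′<K , qk′)

module VectorSearch where
  open import Data.Fin using (Fin)
  open import Data.Fin.Properties using (any?)
  open import Data.Nat using (zero; suc)
  open import Data.Product using (∃; _,_)
  open import Data.Vec using (Vec; []; _∷_)
  open import Relation.Nullary using (Dec; map′)

  any-Vec? : ∀ {B k} {Q : Vec (Fin B) k → Set} → (∀ c → Dec (Q c)) → Dec (∃ Q)
  any-Vec? {k = zero} Q? = map′ ([] ,_) (λ { ([] , q) → q }) (Q? [])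
  any-Vec? {k = suc k} Q? =
    map′ (λ (a , c , q) → a ∷ c , q) (λ { (a ∷ c , q) → a , c , q }) (any? λ a → any-Vec? λ c → Q? (a ∷ c))

module Parities where
  open import Data.Nat using (ℕ; zero; suc; _+_; _*_; _≤_; parity)
  open import Data.Nat.Divisibility using (_∣_; divides; ∣-refl; ∣m∣n⇒∣m+n; ∣n⇒∣m*n)
  open import Data.Nat.DivMod using (_%_; _/_; m≡m%n+[m/n]*n)
  open import Data.Parity.Base as ℙ using (Parity; 0ℙ; 1ℙ; _⁻¹)
  import Data.Parity.Properties as ℙ
  open import Relation.Binary.PropositionalEquality
  open import Relation.Nullary using (¬_; contradiction)

  bit : Parity → ℕ
  bit 0ℙ = 0
  bit 1ℙ = 1

  bit≤1 : ∀ p → bit p ≤ 1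
  bit≤1 0ℙ = ℕ.z≤n
  bit≤1 1ℙ = ℕ.s≤s ℕ.z≤n

  bit-⁻¹ : ∀ p → bit (p ⁻¹) ≢ bit p
  bit-⁻¹ 0ℙ ()
  bit-⁻¹ 1ℙ ()

  parity-suc : ∀ n → parity (suc n) ≡ parity n ⁻¹
  parity-suc n = sym (ℙ.⁻¹-selfInverse (ℙ.suc-homo-⁻¹ n))

  parity-even : ∀ {n} → 2 ∣ n → parity n ≡ 0ℙ
  parity-even (divides q refl) = trans (ℙ.*-homo-* q 2) (ℙ.*-zeroʳ (parity q))

  parity≡0ℙ⇒2∣ : ∀ n → parity n ≡ 0ℙ → 2 ∣ n
  parity≡0ℙ⇒2∣ zero _ = divides 0 refl
  parity≡0ℙ⇒2∣ (suc (suc n)) p≡0 = ∣m∣n⇒∣m+n ∣-refl (parity≡0ℙ⇒2∣ n p≡0)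

  parity-odd : ∀ {n} → ¬ 2 ∣ n → parity n ≡ 1ℙ
  parity-odd {n} 2∤n with parity n in p≡
  ... | 0ℙ = contradiction (parity≡0ℙ⇒2∣ n p≡) 2∤n
  ... | 1ℙ = refl

  parity-% : ∀ {m} .{{_ : ℕ.NonZero m}} a → 2 ∣ m → parity (a % m) ≡ parity a
  parity-% {m} a 2∣m = sym (begin
    parity a                                  ≡⟨ cong parity (m≡m%n+[m/n]*n a m) ⟩
    parity (a % m + a / m * m)                ≡⟨ ℙ.+-homo-+ (a % m) (a / m * m) ⟩
    parity (a % m) ℙ.+ parity (a / m * m)
      ≡⟨ cong (parity (a % m) ℙ.+_) (parity-even (∣n⇒∣m*n (a / m) 2∣m)) ⟩
    parity (a % m) ℙ.+ 0ℙ                     ≡⟨ ℙ.+-identityʳ _ ⟩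
    parity (a % m)                            ∎)
    where open ≡-Reasoning

module FiniteGraphs (G : FinGraph) where
  open FinGraph G
  open IntegerSums
  open IntegerDivisibility
  open UniqueLists
  open import Data.Integer.Divisibility using () renaming (_∣_ to _∣ℤ_)
  open import Data.Bool using (Bool; true; false; if_then_else_; T; _∨_)
  import Data.Bool.Properties as Bool
  open import Data.Integer as ℤ using (ℤ; +_; 0ℤ; _+_; _*_)
  open import Data.List using (List; []; _∷_; map; length; deduplicate)
  open import Data.List.Membership.Propositional using (_∈_; _∉_)
  open import Data.List.Membership.Propositional.Properties
    using (∈-map⁺; ∈-map⁻; ∈-deduplicate⁺; ∈-deduplicate⁻)
  open import Data.List.Properties using (map-cong; map-cong-local; length-map)
  open import Data.List.Relation.Binary.Subset.Propositional using (_⊆_)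
  open import Data.List.Relation.Unary.All as All using (All; []; _∷_)
  open import Data.List.Relation.Unary.Unique.Propositional using (Unique; []; _∷_)
  open import Data.List.Relation.Unary.Unique.DecPropositional.Properties ℤ._≟_ using (deduplicate-!)
  open import Data.Nat using (ℕ; _≤_)
  open import Data.Nat.Divisibility using (_∣?_)
  open import Data.Nat.Properties using (≤-antisym; ≤-trans; ≤-reflexive; <-irrefl)
  open import Data.Product using (∃; _×_; _,_)
  open import Data.Sum using (_⊎_; inj₁; inj₂)
  open import Function using (_∘_; _⇔_; Equivalence)
  open import Relation.Binary.PropositionalEquality
  open import Relation.Nullary using (Dec; yes; no; ¬?; contradiction; isYes; map′)
  open import Relation.Nullary.Decidable using (_→-dec_; _×-dec_)

  range : Labeling G → List ℤ
  range ℓ = deduplicate ℤ._≟_ (map ℓ vertices)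

  module _ (ℓ : Labeling G) where

    ∈-range⁺ : ∀ {x} → x ∈ vertices → ℓ x ∈ range ℓ
    ∈-range⁺ x∈ = ∈-deduplicate⁺ ℤ._≟_ (∈-map⁺ ℓ x∈)

    ∈-range⁻ : ∀ {z} → z ∈ range ℓ → ∃ λ x → x ∈ vertices × z ≡ ℓ x
    ∈-range⁻ z∈ = ∈-map⁻ ℓ (∈-deduplicate⁻ ℤ._≟_ (map ℓ vertices) z∈)

  order-∘-injective : ∀ ℓ ℓ′ (g : ℤ → ℤ) → (∀ x → ℓ′ x ≡ g (ℓ x)) →
    (∀ x y → g (ℓ x) ≡ g (ℓ y) → ℓ x ≡ ℓ y) → order G ℓ′ ≡ order G ℓ
  order-∘-injective ℓ ℓ′ g ℓ′≡gℓ g-inj = ≤-antisym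
    (≤-trans (Unique⇒length≤ (deduplicate-! _) range′⊆) (≤-reflexive (length-map g (range ℓ))))
    (≤-trans (≤-reflexive (sym (length-map g (range ℓ))))
             (Unique⇒length≤ (map⁺-local inj (deduplicate-! _)) ⊆range′))
    where
    range′⊆ : range ℓ′ ⊆ map g (range ℓ)
    range′⊆ z∈ with ∈-range⁻ ℓ′ z∈
    ... | x , x∈ , refl = subst (_∈ map g (range ℓ)) (sym (ℓ′≡gℓ x)) (∈-map⁺ g (∈-range⁺ ℓ x∈))
    ⊆range′ : map g (range ℓ) ⊆ range ℓ′
    ⊆range′ z∈ with ∈-map⁻ g z∈
    ... | y , y∈ , refl with ∈-range⁻ ℓ y∈
    ... | x , x∈ , refl = subst (_∈ range ℓ′) (ℓ′≡gℓ x) (∈-range⁺ ℓ′ x∈)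
    inj : ∀ {y y′} → y ∈ range ℓ → y′ ∈ range ℓ → g y ≡ g y′ → y ≡ y′
    inj y∈ y′∈ with ∈-range⁻ ℓ y∈ | ∈-range⁻ ℓ y′∈
    ... | x , _ , refl | x′ , _ , refl = g-inj x x′

  closedSum-cong : ∀ {ℓ ℓ′} → (∀ x → ℓ x ≡ ℓ′ x) → ∀ x → closedSum G ℓ x ≡ closedSum G ℓ′ x
  closedSum-cong ℓ≗ℓ′ x = cong sumℤ (map-cong ℓ≗ℓ′ (closedNbhd G x))

  closedSum-linear : ∀ (f g : Labeling G) c x →
    closedSum G (λ w → f w + c * g w) x ≡ closedSum G f x + c * closedSum G g x
  closedSum-linear f g c x = sumℤ-linear f g c (closedNbhd G x)

  record Relabeling (n : ℕ) (ℓ ℓ′ : Labeling G) : Set where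
    field
      separates : ∀ x y → ℓ′ x ≡ ℓ′ y → ℓ x ≡ ℓ y
      offset : Labeling G
      congruent : ∀ x → ℓ′ x ≡ ℓ x + + n * offset x

  module _ {n ℓ ℓ′} (r : Relabeling n ℓ ℓ′) where
    open Relabeling r

    proper-relabel : Proper G ℓ → Proper G ℓ′
    proper-relabel proper x y adj = proper x y adj ∘ separates x y

    closed-relabel : ClosedColoringMod G n ℓ → ClosedColoringMod G n ℓ′
    closed-relabel closed x n∣ℓ′ = closed x (∣m+n*o⇒∣m {n} {closedSum G ℓ x} {closedSum G offset x}
      (subst (λ z → + n ∣ℤ z) (trans (closedSum-cong congruent x) (closedSum-linear ℓ offset (+ n) x)) n∣ℓ′))

  ProperClosedColoring : ℕ → Labeling G → Set
  ProperClosedColoring n ℓ = Proper G ℓ × ClosedColoringMod G n ℓ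

  properClosedColoring-relabel : ∀ {n ℓ ℓ′} → Relabeling n ℓ ℓ′ →
    ProperClosedColoring n ℓ → ProperClosedColoring n ℓ′
  properClosedColoring-relabel r (proper , closed) = proper-relabel r proper , closed-relabel r closed

  Complete : Set
  Complete = ∀ x → x ∈ vertices

  module _ (complete : Complete) where

    order≤length : ∀ ℓ zs → (∀ x → ℓ x ∈ zs) → order G ℓ ≤ length zs
    order≤length ℓ zs ℓ∈zs = Unique⇒length≤ (deduplicate-! _) range⊆
      where
      range⊆ : range ℓ ⊆ zs
      range⊆ z∈ with ∈-range⁻ ℓ z∈
      ... | x , _ , refl = ℓ∈zs x

    length≤order : ∀ ℓ xs → Unique (map ℓ xs) → length xs ≤ order G ℓ
    length≤order ℓ xs ℓxs! = ≤-trans (≤-reflexive (sym (length-map ℓ xs))) (Unique⇒length≤ ℓxs! ⊆range)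
      where
      ⊆range : map ℓ xs ⊆ range ℓ
      ⊆range z∈ with ∈-map⁻ ℓ z∈
      ... | x , _ , refl = ∈-range⁺ ℓ (complete x)

    order≤2⇒two-valued : ∀ ℓ {a b} → order G ℓ ≤ 2 → ℓ a ≢ ℓ b → ∀ x → ℓ x ≡ ℓ a ⊎ ℓ x ≡ ℓ b
    order≤2⇒two-valued ℓ {a} {b} order≤2 a≢b x with ℓ x ℤ.≟ ℓ a | ℓ x ℤ.≟ ℓ b
    ... | yes x≡a | _ = inj₁ x≡a
    ... | no _ | yes x≡b = inj₂ x≡b
    ... | no x≢a | no x≢b =
      contradiction (≤-trans (length≤order ℓ (a ∷ b ∷ x ∷ []) three) order≤2) (<-irrefl refl)
      where
      three : Unique (ℓ a ∷ ℓ b ∷ ℓ x ∷ [])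
      three = (a≢b ∷ (x≢a ∘ sym) ∷ []) ∷ ((x≢b ∘ sym) ∷ []) ∷ [] ∷ []

    closedSum-enumeration : ∀ ℓ x S → Unique vertices → Unique S →
      (∀ w → T (isYes (w ≟V x) ∨ adj x w) ⇔ w ∈ S) → closedSum G ℓ x ≡ sumℤ (map ℓ S)
    closedSum-enumeration ℓ x S vertices! S! inN⇔∈S = begin
      closedSum G ℓ x                     ≡⟨ sumℤ-filterᵇ inN ℓ vertices ⟩
      sumℤ (map indicator vertices)       ≡⟨ sumℤ-support _≟V_ indicator S vertices! S! (λ _ → complete _) vanish ⟩
      sumℤ (map indicator S)              ≡⟨ cong sumℤ (map-cong-local (All.tabulate keep)) ⟩
      sumℤ (map ℓ S)                      ∎
      where
      open ≡-Reasoning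
      inN : V → Bool
      inN w = isYes (w ≟V x) ∨ adj x w
      indicator : V → ℤ
      indicator w = if inN w then ℓ w else 0ℤ
      vanish : ∀ w → w ∉ S → indicator w ≡ 0ℤ
      vanish w w∉S with inN w in eq
      ... | true = contradiction (Equivalence.to (inN⇔∈S w) (subst T (sym eq) _)) w∉S
      ... | false = refl
      keep : ∀ {w} → w ∈ S → indicator w ≡ ℓ w
      keep {w} w∈S with inN w in eq
      ... | true = refl
      ... | false = contradiction (subst T eq (Equivalence.from (inN⇔∈S w) w∈S)) λ ()

    ∀? : {Q : V → Set} → (∀ x → Dec (Q x)) → Dec (∀ x → Q x)
    ∀? Q? = map′ (λ all x → All.lookup all (complete x)) (λ ∀Q → All.tabulate λ {x} _ → ∀Q x)
                 (All.all? Q? vertices)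

    proper? : ∀ ℓ → Dec (Proper G ℓ)
    proper? ℓ = ∀? λ x → ∀? λ y → (adj x y Bool.≟ true) →-dec ¬? (ℓ x ℤ.≟ ℓ y)

    closedColoringMod? : ∀ n ℓ → Dec (ClosedColoringMod G n ℓ)
    closedColoringMod? n ℓ = ∀? λ x → ¬? (n ∣? ℤ.∣ closedSum G ℓ x ∣)

    properClosedColoring? : ∀ n ℓ → Dec (ProperClosedColoring n ℓ)
    properClosedColoring? n ℓ = proper? ℓ ×-dec closedColoringMod? n ℓ

module MinimalOrder (G : FinGraph) (complete : FiniteGraphs.Complete G) (n : ℕ) .{{_ : NonZero n}}
  (P : Labeling G → Set) (P? : ∀ ℓ → Dec (P ℓ))
  (P-relabel : ∀ {ℓ ℓ′} → FiniteGraphs.Relabeling G n ℓ ℓ′ → P ℓ → P ℓ′) where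
  open FinGraph G
  open FiniteGraphs G
  open LeastNumber
  open VectorSearch
  open import Data.Fin using (Fin; toℕ; fromℕ<)
  open import Data.Fin.Properties using (toℕ-fromℕ<; toℕ-injective; toℕ<n)
  open import Data.Integer as ℤ using (ℤ; +_; _+_; _-_; _*_; _%ℕ_; _/ℕ_)
  open import Data.Integer.DivMod using (n%ℕd<d; a≡a%ℕn+[a/ℕn]*n)
  import Data.Integer.Properties as ℤ
  open import Data.Integer.Tactic.RingSolver using (solve-∀)
  open import Data.List as List using (length)
  open import Data.List.Membership.DecPropositional ℤ._≟_ using (_∈?_)
  open import Data.List.Relation.Unary.Any using (index)
  open import Data.List.Relation.Unary.Any.Properties using (lookup-index)
  open import Data.Nat as ℕ using (ℕ; _≤_; _<_)
  open import Data.Nat.DivMod using (_%_; [m+kn]%n≡m%n; m<n⇒m%n≡m)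
  open import Data.Nat.Properties using (*-monoˡ-≤; +-monoˡ-<; <-≤-trans; +-cancelˡ-≡; *-cancelʳ-≡)
  open import Data.Product using (Σ; ∃; _×_; _,_)
  open import Data.Vec as Vec using (Vec)
  open import Data.Vec.Properties using (lookup∘tabulate)
  open import Relation.Binary.PropositionalEquality
  open import Relation.Nullary using (Dec; yes; no; contradiction)
  open import Relation.Nullary.Decidable using (_×-dec_)
  open import Function using (_∘_)

  Attained : ℕ → Set
  Attained k = Σ (Labeling G) λ ℓ → P ℓ × order G ℓ ≡ k

  module Normalize (ℓ : Labeling G) where

    rank : ℤ → ℕ
    rank z with z ∈? range ℓ
    ... | yes z∈ = toℕ (index z∈)
    ... | no _ = 0

    rank< : ∀ x → rank (ℓ x) < order G ℓ
    rank< x with ℓ x ∈? range ℓ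
    ... | yes z∈ = toℕ<n (index z∈)
    ... | no z∉ = contradiction (∈-range⁺ ℓ (complete x)) z∉

    rank-injective : ∀ x y → rank (ℓ x) ≡ rank (ℓ y) → ℓ x ≡ ℓ y
    rank-injective x y eq with ℓ x ∈? range ℓ | ℓ y ∈? range ℓ
    ... | yes x∈ | yes y∈ =
      trans (lookup-index x∈) (trans (cong (List.lookup (range ℓ)) (toℕ-injective eq)) (sym (lookup-index y∈)))
    ... | no x∉ | _ = contradiction (∈-range⁺ ℓ (complete x)) x∉
    ... | yes _ | no y∉ = contradiction (∈-range⁺ ℓ (complete y)) y∉

    code : ℤ → ℕ
    code z = z %ℕ n ℕ.+ rank z ℕ.* n

    code< : ∀ x → code (ℓ x) < order G ℓ ℕ.* n
    code< x = <-≤-trans (+-monoˡ-< (rank (ℓ x) ℕ.* n) (n%ℕd<d (ℓ x) n)) (*-monoˡ-≤ n (rank< x))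

    code-injective : ∀ x y → code (ℓ x) ≡ code (ℓ y) → ℓ x ≡ ℓ y
    code-injective x y eq = rank-injective x y (*-cancelʳ-≡ _ _ n (+-cancelˡ-≡ (ℓ x %ℕ n) _ _
      (trans eq (cong (ℕ._+ rank (ℓ y) ℕ.* n) (sym same-residue)))))
      where
      residue : ∀ z → code z % n ≡ z %ℕ n
      residue z = trans ([m+kn]%n≡m%n (z %ℕ n) (rank z) n) (m<n⇒m%n≡m (n%ℕd<d z n))
      same-residue : ℓ x %ℕ n ≡ ℓ y %ℕ n
      same-residue = trans (sym (residue (ℓ x))) (trans (cong (_% n) eq) (residue (ℓ y)))

    code-congruent : ∀ z → + code z ≡ z + + n * (+ rank z - z /ℕ n)
    code-congruent z = begin
      + (z %ℕ n ℕ.+ rank z ℕ.* n)                 ≡⟨ ℤ.pos-+ (z %ℕ n) _ ⟩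
      + (z %ℕ n) + + (rank z ℕ.* n)               ≡⟨ cong (_+_ (+ (z %ℕ n))) (ℤ.pos-* (rank z) n) ⟩
      + (z %ℕ n) + + rank z * + n                 ≡⟨ rearrange (+ (z %ℕ n)) (+ rank z) (z /ℕ n) (+ n) ⟩
      + (z %ℕ n) + z /ℕ n * + n + + n * (+ rank z - z /ℕ n)
        ≡⟨ cong (_+ + n * (+ rank z - z /ℕ n)) (a≡a%ℕn+[a/ℕn]*n z n) ⟨
      z + + n * (+ rank z - z /ℕ n)               ∎
      where
      open ≡-Reasoning
      rearrange : ∀ r k q d → r + k * d ≡ r + q * d + d * (k - q)
      rearrange = solve-∀

    module _ (ℓ′ : Labeling G) (ℓ′≡code : ∀ x → ℓ′ x ≡ + code (ℓ x)) where

      relabeling : Relabeling n ℓ ℓ′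
      relabeling = record
        { separates = λ x y eq →
            code-injective x y (ℤ.+-injective (trans (sym (ℓ′≡code x)) (trans eq (ℓ′≡code y))))
        ; offset = λ x → + rank (ℓ x) - ℓ x /ℕ n
        ; congruent = λ x → trans (ℓ′≡code x) (code-congruent (ℓ x))
        }

      order-normalized : order G ℓ′ ≡ order G ℓ
      order-normalized = order-∘-injective ℓ ℓ′ (λ z → + code z) ℓ′≡code
        (λ x y eq → code-injective x y (ℤ.+-injective eq))

  fromVec : ∀ {B} → Vec (Fin B) (length vertices) → Labeling G
  fromVec c x = + toℕ (Vec.lookup c (index (complete x)))

  attained? : ∀ k → Dec (Attained k)
  attained? k with any-Vec? {k ℕ.* n} (λ c → P? (fromVec c) ×-dec (order G (fromVec c) ℕ.≟ k))
  ... | yes (c , p , o) = yes (fromVec c , p , o)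
  ... | no none = no λ (ℓ , p , o) → none (encode ℓ p o)
    where
    encode : ∀ ℓ → P ℓ → order G ℓ ≡ k → ∃ λ c → P (fromVec c) × order G (fromVec c) ≡ k
    encode ℓ p refl = c , P-relabel (relabeling (fromVec c) c≡code) p , trans (order-normalized (fromVec c) c≡code) refl
      where
      open Normalize ℓ
      c : Vec (Fin (order G ℓ ℕ.* n)) (length vertices)
      c = Vec.tabulate λ i → fromℕ< (code< (List.lookup vertices i))
      c≡code : ∀ x → fromVec c x ≡ + code (ℓ x)
      c≡code x = cong +_ (trans (cong toℕ (lookup∘tabulate _ (index (complete x))))
        (trans (toℕ-fromℕ< _) (cong (code ∘ ℓ) (sym (lookup-index (complete x))))))

  minimal-order : ∀ {ℓ} → P ℓ → Σ ℕ λ k → Attained k × (∀ ℓ → P ℓ → k ≤ order G ℓ)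
  minimal-order {ℓ} p with least attained? (ℓ , p , refl)
  ... | k , attained , below = k , attained , λ ℓ′ p′ → below _ (ℓ′ , p′ , refl)

module Cyclic (m : ℕ) .{{_ : NonZero m}} where
  open import Data.Bool using (T; _∨_)
  open import Data.Bool.Properties using (T-∨)
  open import Data.Fin using (Fin; toℕ)
  open import Data.Fin.Properties using (toℕ-fromℕ<; toℕ-injective; toℕ<n)
  open import Data.Nat using (ℕ; zero; suc; _+_; _*_; _∸_; _≤_; _<_)
  open import Data.Nat.DivMod using (_%_; _/_; _mod_; %-distribˡ-+; m%n%n≡m%n; [m+n]%n≡m%n; m<n⇒m%n≡m; m≡m%n+[m/n]*n)
  open import Data.Nat.Properties
  open import Data.Product using (_×_; _,_)
  open import Data.Sum using (_⊎_; inj₁; inj₂)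
  open import Function using (_⇔_; mk⇔; Equivalence)
  open import Relation.Binary.PropositionalEquality

  infixl 6 _⊕_ _⊖_

  _⊕_ : Fin m → ℕ → Fin m
  i ⊕ s = (toℕ i + s) mod m

  _⊖_ : Fin m → ℕ → Fin m
  i ⊖ s = i ⊕ (m ∸ s)

  toℕ-mod : ∀ t → toℕ (t mod m) ≡ t % m
  toℕ-mod t = toℕ-fromℕ< _

  [a%m+b]%m≡[a+b]%m : ∀ a b → (a % m + b) % m ≡ (a + b) % m
  [a%m+b]%m≡[a+b]%m a b = begin
    (a % m + b) % m           ≡⟨ %-distribˡ-+ (a % m) b m ⟩
    (a % m % m + b % m) % m   ≡⟨ cong (λ c → (c + b % m) % m) (m%n%n≡m%n a m) ⟩
    (a % m + b % m) % m       ≡⟨ %-distribˡ-+ a b m ⟨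
    (a + b) % m               ∎
    where open ≡-Reasoning

  mod-⊕ : ∀ t s → t mod m ⊕ s ≡ (t + s) mod m
  mod-⊕ t s = toℕ-injective (begin
    toℕ (t mod m ⊕ s)         ≡⟨ toℕ-mod (toℕ (t mod m) + s) ⟩
    (toℕ (t mod m) + s) % m   ≡⟨ cong (λ a → (a + s) % m) (toℕ-mod t) ⟩
    (t % m + s) % m           ≡⟨ [a%m+b]%m≡[a+b]%m t s ⟩
    (t + s) % m               ≡⟨ toℕ-mod (t + s) ⟨
    toℕ ((t + s) mod m)       ∎)
    where open ≡-Reasoning

  ⊕-⊕ : ∀ i a b → i ⊕ a ⊕ b ≡ i ⊕ (a + b)
  ⊕-⊕ i a b = trans (mod-⊕ (toℕ i + a) b) (cong (_mod m) (+-assoc (toℕ i) a b))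

  ⊕-period : ∀ i → i ⊕ m ≡ i
  ⊕-period i = toℕ-injective (trans (toℕ-mod _) (trans ([m+n]%n≡m%n (toℕ i) m) (m<n⇒m%n≡m (toℕ<n i))))

  ⊖-⊕ : ∀ {s} i → s ≤ m → i ⊖ s ⊕ s ≡ i
  ⊖-⊕ i s≤m = trans (⊕-⊕ i _ _) (trans (cong (i ⊕_) (m∸n+n≡m s≤m)) (⊕-period i))

  ⊕-⊖ : ∀ {s} i → s ≤ m → i ⊕ s ⊖ s ≡ i
  ⊕-⊖ i s≤m = trans (⊕-⊕ i _ _) (trans (cong (i ⊕_) (m+[n∸m]≡n s≤m)) (⊕-period i))

  ⊕-≢ : ∀ {t} i → 0 < t → t < m → i ⊕ t ≢ i
  ⊕-≢ {t} i 0<t t<m i⊕t≡i = not-multiple ((x + t) / m) (+-cancelˡ-≡ x t _ (begin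
    x + t                          ≡⟨ m≡m%n+[m/n]*n (x + t) m ⟩
    (x + t) % m + (x + t) / m * m  ≡⟨ cong (_+ (x + t) / m * m) (trans (sym (toℕ-mod _)) (cong toℕ i⊕t≡i)) ⟩
    x + (x + t) / m * m            ∎))
    where
    open ≡-Reasoning
    x = toℕ i
    not-multiple : ∀ q → t ≢ q * m
    not-multiple zero t≡0 = <⇒≢ 0<t (sym t≡0)
    not-multiple (suc q) t≡m+qm = <⇒≱ t<m (subst (m ≤_) (sym t≡m+qm) (m≤m+n m (q * m)))

  module _ {s : ℕ} (0<s : 0 < s) (2s<m : 2 * s < m) where

    private
      s+s<m : s + s < m
      s+s<m = subst (_< m) (cong (s +_) (+-identityʳ s)) 2s<m

      s≤m : s ≤ m
      s≤m = ≤-trans (m≤m+n s s) (<⇒≤ s+s<m)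

    ⊕⊖-distinct : ∀ i → i ≢ i ⊕ s × i ≢ i ⊖ s × i ⊕ s ≢ i ⊖ s
    ⊕⊖-distinct i = i≢i⊕s , i≢i⊖s , i⊕s≢i⊖s
      where
      i≢i⊕s : i ≢ i ⊕ s
      i≢i⊕s i≡i⊕s = ⊕-≢ i 0<s (≤-<-trans (m≤m+n s s) s+s<m) (sym i≡i⊕s)
      i≢i⊖s : i ≢ i ⊖ s
      i≢i⊖s i≡i⊖s = i≢i⊕s (trans (sym (⊖-⊕ i s≤m)) (cong (_⊕ s) (sym i≡i⊖s)))
      i⊕s≢i⊖s : i ⊕ s ≢ i ⊖ s
      i⊕s≢i⊖s i⊕s≡i⊖s = ⊕-≢ (i ⊖ s) (<-≤-trans 0<s (m≤m+n s s)) s+s<m (begin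
        i ⊖ s ⊕ (s + s)   ≡⟨ ⊕-⊕ (i ⊖ s) s s ⟨
        i ⊖ s ⊕ s ⊕ s     ≡⟨ cong (_⊕ s) (⊖-⊕ i s≤m) ⟩
        i ⊕ s             ≡⟨ i⊕s≡i⊖s ⟩
        i ⊖ s             ∎)
        where open ≡-Reasoning

  T-shiftIs : ∀ j i s k → T (shiftIs m j i s k) ⇔ (k ≡ i ⊕ s)
  T-shiftIs j i s k = mk⇔
    (λ t → toℕ-injective (trans (≡ᵇ⇒≡ (toℕ k) _ t) (sym (toℕ-mod _))))
    (λ k≡i⊕s → ≡⇒≡ᵇ (toℕ k) _ (trans (cong toℕ k≡i⊕s) (toℕ-mod _)))

  T-circulant : ∀ j {s} i k → s ≤ m →
    T (shiftIs m j i s k ∨ shiftIs m j k s i) ⇔ (k ≡ i ⊕ s ⊎ k ≡ i ⊖ s)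
  T-circulant j {s} i k s≤m = mk⇔ to from
    where
    to : T (shiftIs m j i s k ∨ shiftIs m j k s i) → k ≡ i ⊕ s ⊎ k ≡ i ⊖ s
    to t with Equivalence.to T-∨ t
    ... | inj₁ t₁ = inj₁ (Equivalence.to (T-shiftIs j i s k) t₁)
    ... | inj₂ t₂ = inj₂ (trans (sym (⊕-⊖ k s≤m)) (cong (_⊖ s) (sym (Equivalence.to (T-shiftIs j k s i) t₂))))
    from : k ≡ i ⊕ s ⊎ k ≡ i ⊖ s → T (shiftIs m j i s k ∨ shiftIs m j k s i)
    from (inj₁ refl) = Equivalence.from T-∨ (inj₁ (Equivalence.from (T-shiftIs j i s k) refl))
    from (inj₂ refl) = Equivalence.from T-∨ (inj₂ (Equivalence.from (T-shiftIs j k s i) (sym (⊖-⊕ i s≤m))))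

module CirculantColoring (m s : ℕ) .{{_ : NonZero m}} .{{_ : NonZero s}} (2s<m : 2 ℕ.* s ℕ.< m) where
  open Cyclic m
  open Parities
  open import Data.Fin using (Fin; toℕ)
  open import Data.Fin.Properties using (toℕ<n)
  open import Data.Nat using (ℕ; suc; _+_; _∸_; _≤_; _<_; s≤s; _≤?_; _<?_; parity)
  open import Data.Nat.DivMod using (_%_; _/_; m<n⇒m%n≡m; m≤n⇒[n∸m]%m≡n%m; m/n≡1+[m∸n]/n; m<n⇒m/n≡0)
  open import Data.Nat.Properties
  open import Data.Parity.Base using (_⁻¹)
  open import Function using (_∘_)
  open import Relation.Binary.PropositionalEquality
  open import Relation.Nullary using (yes; no; contradiction)

  -- Blocks of s consecutive vertices alternate between colors 0 and 1 and the last s vertices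
  -- get color 2; as 2s < m, a step by s either enters the next block or wraps from color 2 to 0.
  colorℕ : ℕ → ℕ
  colorℕ x with m ∸ s ≤? x
  ... | yes _ = 2
  ... | no _ = bit (parity (x / s))

  color : Fin m → ℕ
  color i = colorℕ (toℕ i)

  color≤2 : ∀ i → color i ≤ 2
  color≤2 i with m ∸ s ≤? toℕ i
  ... | yes _ = ≤-refl
  ... | no _ = m≤n⇒m≤1+n (bit≤1 _)

  private
    color-high : ∀ {x} → m ∸ s ≤ x → colorℕ x ≡ 2
    color-high {x} high with m ∸ s ≤? x
    ... | yes _ = refl
    ... | no low = contradiction high low

    color-low : ∀ {x} → x < m ∸ s → colorℕ x ≡ bit (parity (x / s))
    color-low {x} low with m ∸ s ≤? x
    ... | yes high = contradiction high (<⇒≱ low)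
    ... | no _ = refl

    s≤m∸s : s ≤ m ∸ s
    s≤m∸s = m+n≤o⇒m≤o∸n s (≤-trans (≤-reflexive (cong (s +_) (sym (+-identityʳ s)))) (<⇒≤ 2s<m))

    color-step : ∀ x → x + s < m → colorℕ (x + s) ≢ colorℕ x
    color-step x x+s<m = step (color-low (m+n≤o⇒m≤o∸n (suc x) x+s<m))
      where
      open ≡-Reasoning
      [x+s]/s≡1+x/s : (x + s) / s ≡ suc (x / s)
      [x+s]/s≡1+x/s = trans (m/n≡1+[m∸n]/n (m≤n+m s x)) (cong (λ y → suc (y / s)) (m+n∸n≡m x s))
      step : colorℕ x ≡ bit (parity (x / s)) → colorℕ (x + s) ≢ colorℕ x
      step color-x eq with m ∸ s ≤? x + s
      ... | yes _ = <⇒≢ (s≤s (bit≤1 _)) (trans (sym color-x) (sym eq))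
      ... | no _ = bit-⁻¹ (parity (x / s)) (begin
        bit (parity (x / s) ⁻¹)     ≡⟨ cong bit (parity-suc (x / s)) ⟨
        bit (parity (suc (x / s)))  ≡⟨ cong (bit ∘ parity) [x+s]/s≡1+x/s ⟨
        bit (parity ((x + s) / s))  ≡⟨ eq ⟩
        colorℕ x                    ≡⟨ color-x ⟩
        bit (parity (x / s))        ∎)

    wrapped<s : ∀ x → x < m → x + s ∸ m < s
    wrapped<s x x<m = m<n+o⇒m∸n<o (x + s) m (+-monoˡ-< s x<m)

    color-wrap : ∀ x → x < m → m ≤ x + s → colorℕ (x + s ∸ m) ≢ colorℕ x
    color-wrap x x<m m≤x+s eq = 0≢2 (begin
      0                             ≡⟨ cong (bit ∘ parity) (m<n⇒m/n≡0 (wrapped<s x x<m)) ⟨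
      bit (parity ((x + s ∸ m) / s)) ≡⟨ color-low (<-≤-trans (wrapped<s x x<m) s≤m∸s) ⟨
      colorℕ (x + s ∸ m)            ≡⟨ eq ⟩
      colorℕ x                      ≡⟨ color-high (m≤n+o⇒m∸n≤o m s (subst (m ≤_) (+-comm x s) m≤x+s)) ⟩
      2                             ∎)
      where
      open ≡-Reasoning
      0≢2 : 0 ≢ 2
      0≢2 ()

  color-⊕ : ∀ i → color (i ⊕ s) ≢ color i
  color-⊕ i with toℕ i + s <? m
  ... | yes x+s<m = subst (λ y → colorℕ y ≢ color i) (sym (trans (toℕ-mod _) (m<n⇒m%n≡m x+s<m)))
    (color-step (toℕ i) x+s<m)
  ... | no x+s≮m = subst (λ y → colorℕ y ≢ color i) (sym (trans (toℕ-mod _) wrapped))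
    (color-wrap (toℕ i) (toℕ<n i) (≮⇒≥ x+s≮m))
    where
    wrapped : (toℕ i + s) % m ≡ toℕ i + s ∸ m
    wrapped = trans (sym (m≤n⇒[n∸m]%m≡n%m (≮⇒≥ x+s≮m)))
      (m<n⇒m%n≡m (<-≤-trans (wrapped<s (toℕ i) (toℕ<n i)) (≤-trans s≤m∸s (m∸n≤m m s))))

module Petersen (m j : ℕ) .{{_ : NonZero m}} (1≤j : 1 ℕ.≤ j) (2j<m : 2 ℕ.* j ℕ.< m) where
  open Cyclic m
  open IntegerSums using (sumℤ)
  open FiniteGraphs (GP m j)
  open import Data.Nat.DivMod using (_mod_)
  open import Data.Bool using (T; true; _∨_)
  open import Data.Bool.Properties using (T-∨; T-≡)
  open import Data.Empty using (⊥)
  open import Data.Fin using (Fin)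
  open import Data.List using (List; []; _∷_; map; allFin)
  open import Data.List.Membership.Propositional using (_∈_)
  open import Data.List.Membership.Propositional.Properties using (∈-map⁺; ∈-map⁻; ∈-++⁺ˡ; ∈-++⁺ʳ; ∈-allFin)
  open import Data.List.Relation.Unary.All using ([]; _∷_)
  open import Data.List.Relation.Unary.Any using (here; there)
  open import Data.List.Relation.Unary.Unique.Propositional using (Unique; []; _∷_)
  import Data.List.Relation.Unary.Unique.Propositional.Properties as Unique
  open import Data.Nat using (_≤_; _<_; _*_)
  open import Data.Nat.Properties using (≤-trans; ≤-<-trans; <⇒≤; *-monoʳ-≤; m≤n*m)
  open import Data.Product using (_×_; _,_)
  open import Data.Sum as Sum using (_⊎_; inj₁; inj₂)
  open import Function using (_∘_; _⇔_; mk⇔; Equivalence)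
  open import Relation.Binary.PropositionalEquality
  open import Relation.Nullary using (isYes)
  open import Relation.Nullary.Decidable using (toWitness; fromWitness)

  3≤m : 3 ≤ m
  3≤m = ≤-<-trans (*-monoʳ-≤ 2 1≤j) 2j<m

  1≤m : 1 ≤ m
  1≤m = ≤-trans (ℕ.s≤s ℕ.z≤n) 3≤m

  j≤m : j ≤ m
  j≤m = ≤-trans (m≤n*m j 2) (<⇒≤ 2j<m)

  next prev spoke : PVtx m → PVtx m
  next (v i) = v (i ⊕ 1)
  next (u i) = u (i ⊕ j)
  prev (v i) = v (i ⊖ 1)
  prev (u i) = u (i ⊖ j)
  spoke (v i) = u i
  spoke (u i) = v i

  closedNeighbourhood : PVtx m → List (PVtx m)
  closedNeighbourhood x = x ∷ next x ∷ prev x ∷ spoke x ∷ []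

  next-prev : ∀ x → next (prev x) ≡ x
  next-prev (v i) = cong v (⊖-⊕ i 1≤m)
  next-prev (u i) = cong u (⊖-⊕ i j≤m)

  T-adj-next : ∀ x → T (petersenAdj m j x (next x))
  T-adj-next (v i) = Equivalence.from (T-circulant j i (i ⊕ 1) 1≤m) (inj₁ refl)
  T-adj-next (u i) = Equivalence.from (T-circulant j i (i ⊕ j) j≤m) (inj₁ refl)

  T-adj-prev : ∀ x → T (petersenAdj m j x (prev x))
  T-adj-prev (v i) = Equivalence.from (T-circulant j i (i ⊖ 1) 1≤m) (inj₂ refl)
  T-adj-prev (u i) = Equivalence.from (T-circulant j i (i ⊖ j) j≤m) (inj₂ refl)

  T-adj-spoke : ∀ x → T (petersenAdj m j x (spoke x))
  T-adj-spoke (v i) = fromWitness refl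
  T-adj-spoke (u i) = fromWitness refl

  adj-next : ∀ x → petersenAdj m j x (next x) ≡ true
  adj-next x = Equivalence.to T-≡ (T-adj-next x)

  adj-spoke : ∀ x → petersenAdj m j x (spoke x) ≡ true
  adj-spoke x = Equivalence.to T-≡ (T-adj-spoke x)

  adjacent⇒neighbour : ∀ x y → T (petersenAdj m j x y) → y ≡ next x ⊎ y ≡ prev x ⊎ y ≡ spoke x
  adjacent⇒neighbour (v i) (v k) t = Sum.map (cong v) (inj₁ ∘ cong v) (Equivalence.to (T-circulant j i k 1≤m) t)
  adjacent⇒neighbour (v i) (u k) t = inj₂ (inj₂ (cong u (sym (toWitness t))))
  adjacent⇒neighbour (u i) (v k) t = inj₂ (inj₂ (cong v (sym (toWitness t))))
  adjacent⇒neighbour (u i) (u k) t = Sum.map (cong u) (inj₁ ∘ cong u) (Equivalence.to (T-circulant j i k j≤m) t)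

  proper-by-neighbours : ∀ ℓ → (∀ x → ℓ (next x) ≢ ℓ x) → (∀ x → ℓ (spoke x) ≢ ℓ x) →
    Proper (GP m j) ℓ
  proper-by-neighbours ℓ next≢ spoke≢ x y adj with adjacent⇒neighbour x y (Equivalence.from T-≡ adj)
  ... | inj₁ refl = next≢ x ∘ sym
  ... | inj₂ (inj₁ refl) = subst (λ z → ℓ z ≢ ℓ (prev x)) (next-prev x) (next≢ (prev x))
  ... | inj₂ (inj₂ refl) = spoke≢ x ∘ sym

  vertices-complete : ∀ x → x ∈ FinGraph.vertices (GP m j)
  vertices-complete (v i) = ∈-++⁺ˡ (∈-map⁺ v (∈-allFin i))
  vertices-complete (u i) = ∈-++⁺ʳ (map v (allFin m)) (∈-map⁺ u (∈-allFin i))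

  vertices-unique : Unique (FinGraph.vertices (GP m j))
  vertices-unique =
    Unique.++⁺ (Unique.map⁺ v-injective (Unique.allFin⁺ m)) (Unique.map⁺ u-injective (Unique.allFin⁺ m)) disjoint
    where
    v-injective : ∀ {a b} → v {m} a ≡ v b → a ≡ b
    v-injective refl = refl
    u-injective : ∀ {a b} → u {m} a ≡ u b → a ≡ b
    u-injective refl = refl
    disjoint : ∀ {x} → x ∈ map v (allFin m) × x ∈ map u (allFin m) → ⊥
    disjoint (x∈v , x∈u) with ∈-map⁻ v x∈v | ∈-map⁻ u x∈u
    ... | _ , _ , refl | _ , _ , ()

  ∈-closedNeighbourhood : ∀ x w → T (isYes (PVtx-≟ w x) ∨ petersenAdj m j x w) ⇔ w ∈ closedNeighbourhood x
  ∈-closedNeighbourhood x w = mk⇔ to from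
    where
    to : T (isYes (PVtx-≟ w x) ∨ petersenAdj m j x w) → w ∈ closedNeighbourhood x
    to t with Equivalence.to T-∨ t
    ... | inj₁ w≡x = here (toWitness w≡x)
    ... | inj₂ adj with adjacent⇒neighbour x w adj
    ...   | inj₁ w≡next = there (here w≡next)
    ...   | inj₂ (inj₁ w≡prev) = there (there (here w≡prev))
    ...   | inj₂ (inj₂ w≡spoke) = there (there (there (here w≡spoke)))
    adjacent : ∀ {y} → T (petersenAdj m j x y) → T (isYes (PVtx-≟ y x) ∨ petersenAdj m j x y)
    adjacent {y} = Equivalence.from (T-∨ {isYes (PVtx-≟ y x)}) ∘ inj₂
    from : w ∈ closedNeighbourhood x → T (isYes (PVtx-≟ w x) ∨ petersenAdj m j x w)
    from (here refl) = Equivalence.from (T-∨ {isYes (PVtx-≟ x x)}) (inj₁ (fromWitness refl))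
    from (there (here refl)) = adjacent (T-adj-next x)
    from (there (there (here refl))) = adjacent (T-adj-prev x)
    from (there (there (there (here refl)))) = adjacent (T-adj-spoke x)

  rim-unique : ∀ {s} (c d : Fin m → PVtx m) → (∀ {a b} → c a ≡ c b → a ≡ b) → (∀ {a b} → c a ≢ d b) →
    0 < s → 2 * s < m → ∀ i → Unique (c i ∷ c (i ⊕ s) ∷ c (i ⊖ s) ∷ d i ∷ [])
  rim-unique c d c-inj c≢d 0<s 2s<m i with ⊕⊖-distinct 0<s 2s<m i
  ... | i≢i⊕s , i≢i⊖s , i⊕s≢i⊖s =
    ((i≢i⊕s ∘ c-inj) ∷ (i≢i⊖s ∘ c-inj) ∷ c≢d ∷ []) ∷
    ((i⊕s≢i⊖s ∘ c-inj) ∷ c≢d ∷ []) ∷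
    (c≢d ∷ []) ∷ [] ∷ []

  closedNeighbourhood-unique : ∀ x → Unique (closedNeighbourhood x)
  closedNeighbourhood-unique (v i) = rim-unique v u (λ { refl → refl }) (λ ()) (ℕ.s≤s ℕ.z≤n) 3≤m i
  closedNeighbourhood-unique (u i) = rim-unique u v (λ { refl → refl }) (λ ()) 1≤j 2j<m i

  closedSum≡ : ∀ ℓ x → closedSum (GP m j) ℓ x ≡ sumℤ (map ℓ (closedNeighbourhood x))
  closedSum≡ ℓ x = closedSum-enumeration vertices-complete ℓ x (closedNeighbourhood x)
    vertices-unique (closedNeighbourhood-unique x) (∈-closedNeighbourhood x)

  order≥2 : ∀ ℓ → Proper (GP m j) ℓ → 2 ≤ order (GP m j) ℓ
  order≥2 ℓ proper =
    length≤order vertices-complete ℓ (v o ∷ u o ∷ []) ((proper (v o) (u o) (adj-spoke (v o)) ∷ []) ∷ [] ∷ [])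
    where
    o : Fin m
    o = 0 mod m

module AffineRelabeling (m j : ℕ) .{{_ : NonZero m}} (1≤j : 1 ℕ.≤ j) (2j<m : 2 ℕ.* j ℕ.< m)
  (n : ℕ) .{{_ : NonZero n}} where
  open IntegerDivisibility using (∣m+n*o⇒∣m)
  open FiniteGraphs (GP m j)
  open Petersen m j 1≤j 2j<m
  open import Data.Integer using (+_; 1ℤ; _+_; _*_)
  open import Data.Integer.Divisibility using () renaming (_∣_ to _∣ℤ_)
  open import Data.Integer.Properties using (*-cancelˡ-≡; +-0-abelianGroup)
  open import Algebra.Properties.AbelianGroup +-0-abelianGroup using () renaming (∙-cancelˡ to +-cancelˡ)
  open import Function using (_∘_)
  open import Relation.Binary.PropositionalEquality

  shifted : Labeling (GP m j) → Labeling (GP m j)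
  shifted ℓ x = 1ℤ + + n * ℓ x

  private
    shift-injective : ∀ {a b} → 1ℤ + + n * a ≡ 1ℤ + + n * b → a ≡ b
    shift-injective eq = *-cancelˡ-≡ (+ n) _ _ (+-cancelˡ 1ℤ _ _ eq)

  shifted-proper : ∀ ℓ → Proper (GP m j) ℓ → Proper (GP m j) (shifted ℓ)
  shifted-proper ℓ proper x y adj = proper x y adj ∘ shift-injective

  shifted-order : ∀ ℓ → order (GP m j) (shifted ℓ) ≡ order (GP m j) ℓ
  shifted-order ℓ = order-∘-injective ℓ (shifted ℓ) (λ z → 1ℤ + + n * z) (λ _ → refl) (λ _ _ → shift-injective)

  closedSum-shifted : ∀ ℓ x → closedSum (GP m j) (shifted ℓ) x ≡ + 4 + + n * closedSum (GP m j) ℓ x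
  closedSum-shifted ℓ x = trans (closedSum-linear (λ _ → 1ℤ) ℓ (+ n) x)
    (cong (_+ + n * closedSum (GP m j) ℓ x) (closedSum≡ (λ _ → 1ℤ) x))

  shifted-closed : ∀ ℓ → ¬ n ∣ 4 → ClosedColoringMod (GP m j) n (shifted ℓ)
  shifted-closed ℓ n∤4 x n∣sum =
    n∤4 (∣m+n*o⇒∣m {n} {+ 4} {closedSum (GP m j) ℓ x} (subst (+ n ∣ℤ_) (closedSum-shifted ℓ x) n∣sum))

module OddCycle (m j : ℕ) .{{_ : NonZero m}} (1≤j : 1 ℕ.≤ j) (2j<m : 2 ℕ.* j ℕ.< m) where
  open Cyclic m using (_⊕_; mod-⊕; ⊕-period)
  open Parities using (parity-suc; parity-odd; parity-even)
  open FiniteGraphs (GP m j)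
  open Petersen m j 1≤j 2j<m
  open import Data.Fin using (Fin)
  open import Data.Integer using (ℤ)
  open import Data.Nat using (zero; suc; _≤_; s≤s⁻¹; parity)
  open import Data.Nat.Divisibility using (_∣?_)
  open import Data.Nat.DivMod using (_mod_)
  open import Data.Nat.Properties using (+-comm; ≮⇒≥)
  open import Data.Parity.Base using (Parity; 0ℙ; 1ℙ; _⁻¹)
  open import Data.Product using (_×_; _,_)
  open import Data.Sum using (_⊎_; inj₁; inj₂)
  open import Function using (_∘_)
  open import Relation.Binary.PropositionalEquality
  open import Relation.Nullary using (contradiction)
  open import Relation.Nullary.Decidable using (decidable-stable)

  module _ (ℓ : Labeling (GP m j)) (proper : Proper (GP m j) ℓ) (order≤2 : order (GP m j) ℓ ≤ 2) where

    private
      walk : ℕ → PVtx m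
      walk t = v (t mod m)

      next-walk : ∀ t → next (walk t) ≡ walk (suc t)
      next-walk t = cong v (trans (mod-⊕ t 1) (cong (_mod m) (+-comm t 1)))

      walk-adjacent : ∀ t → ℓ (walk t) ≢ ℓ (walk (suc t))
      walk-adjacent t = subst (λ y → ℓ (walk t) ≢ ℓ y) (next-walk t) (proper _ _ (adj-next (walk t)))

      labelAt : Parity → ℤ
      labelAt 0ℙ = ℓ (walk 0)
      labelAt 1ℙ = ℓ (walk 1)

      two-valued : ∀ x → ℓ x ≡ labelAt 0ℙ ⊎ ℓ x ≡ labelAt 1ℙ
      two-valued = order≤2⇒two-valued vertices-complete ℓ order≤2 (walk-adjacent 0)

      other-label : ∀ x p → ℓ x ≢ labelAt p → ℓ x ≡ labelAt (p ⁻¹)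
      other-label x p ℓx≢ with p | two-valued x
      ... | 0ℙ | inj₁ ℓx≡ = contradiction ℓx≡ ℓx≢
      ... | 0ℙ | inj₂ ℓx≡ = ℓx≡
      ... | 1ℙ | inj₁ ℓx≡ = ℓx≡
      ... | 1ℙ | inj₂ ℓx≡ = contradiction ℓx≡ ℓx≢

      walk-label : ∀ t → ℓ (walk t) ≡ labelAt (parity t)
      walk-label zero = refl
      walk-label (suc t) = trans (other-label (walk (suc t)) (parity t) λ eq → walk-adjacent t (trans (walk-label t) (sym eq)))
        (cong labelAt (sym (parity-suc t)))

    -- The two labels alternate along the outer cycle, so m is even; for even j the cycle
    -- v₀ v₁ … v_j u_j u₀ would be odd.
    order≤2⇒bipartite : 2 ∣ m × ¬ 2 ∣ j
    order≤2⇒bipartite = decidable-stable (2 ∣? m) m-odd-impossible , j-even-impossible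
      where
      m-odd-impossible : ¬ ¬ 2 ∣ m
      m-odd-impossible 2∤m = walk-adjacent 0 (begin
        ℓ (walk 0)             ≡⟨ cong (ℓ ∘ v) (trans (sym (⊕-period _)) (mod-⊕ 0 m)) ⟩
        ℓ (walk m)             ≡⟨ walk-label m ⟩
        labelAt (parity m)    ≡⟨ cong labelAt (parity-odd 2∤m) ⟩
        ℓ (walk 1)             ∎)
        where open ≡-Reasoning
      j-even-impossible : ¬ 2 ∣ j
      j-even-impossible 2∣j = proper _ _ (adj-next (u o)) (trans ℓuo≡ (sym ℓuj≡))
        where
        o : Fin m
        o = 0 mod m
        ℓuo≡ : ℓ (u o) ≡ labelAt 1ℙ
        ℓuo≡ = other-label (u o) 0ℙ (proper _ _ (adj-spoke (walk 0)) ∘ sym)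
        ℓuj≡ : ℓ (next (u o)) ≡ labelAt 1ℙ
        ℓuj≡ = other-label (next (u o)) 0ℙ λ eq → proper _ _ (adj-spoke (walk j)) (begin
          ℓ (walk j)           ≡⟨ walk-label j ⟩
          labelAt (parity j)  ≡⟨ cong labelAt (parity-even 2∣j) ⟩
          labelAt 0ℙ          ≡⟨ eq ⟨
          ℓ (u (o ⊕ j))        ≡⟨ cong (ℓ ∘ u) (mod-⊕ 0 j) ⟩
          ℓ (spoke (walk j))   ∎)
          where open ≡-Reasoning

  order≥3 : ∀ ℓ → ¬ (2 ∣ m × ¬ 2 ∣ j) → Proper (GP m j) ℓ → 3 ≤ order (GP m j) ℓ
  order≥3 ℓ not-bipartite proper =
    ≮⇒≥ λ order<3 → not-bipartite (order≤2⇒bipartite ℓ proper (s≤s⁻¹ order<3))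

module BipartiteLabeling (m j : ℕ) .{{_ : NonZero m}} (1≤j : 1 ℕ.≤ j) (2j<m : 2 ℕ.* j ℕ.< m)
  (2∣m : 2 ∣ m) (2∤j : ¬ 2 ∣ j) where
  open Cyclic m
  open Parities
  open IntegerDivisibility
  open FiniteGraphs (GP m j)
  open Petersen m j 1≤j 2j<m
  open import Data.Fin using (toℕ)
  open import Data.Integer as ℤ using (ℤ; +_; 0ℤ)
  import Data.Integer.Properties as ℤ
  open import Data.List using ([]; _∷_)
  open import Data.List.Membership.Propositional using (_∈_)
  open import Data.List.Relation.Unary.Any using (here; there)
  open import Data.Nat using (ℕ; _+_; _≤_; parity)
  open import Data.Nat.Divisibility using (∣1⇒≡1)
  open import Data.Nat.DivMod using (_%_)
  open import Data.Nat.Properties using (≤-antisym; +-comm)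
  open import Data.Parity.Base as ℙ using (Parity; 0ℙ; 1ℙ; _⁻¹)
  import Data.Parity.Properties as ℙ
  open import Data.Product using (_,_)
  open import Function using (_∘_)
  open import Relation.Binary.PropositionalEquality
  open import Relation.Nullary using (¬_)

  parity-⊕ : ∀ {s} i → ¬ 2 ∣ s → parity (toℕ (i ⊕ s)) ≡ parity (toℕ i) ⁻¹
  parity-⊕ {s} i 2∤s = begin
    parity (toℕ (i ⊕ s))          ≡⟨ cong parity (toℕ-mod _) ⟩
    parity ((toℕ i + s) % m)      ≡⟨ parity-% _ 2∣m ⟩
    parity (toℕ i + s)            ≡⟨ cong parity (+-comm (toℕ i) s) ⟩
    parity (s + toℕ i)            ≡⟨ ℙ.+-homo-+ s (toℕ i) ⟩
    parity s ℙ.+ parity (toℕ i)   ≡⟨ cong (ℙ._+ parity (toℕ i)) (parity-odd 2∤s) ⟩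
    parity (toℕ i) ⁻¹             ∎
    where open ≡-Reasoning

  side : PVtx m → Parity
  side (v i) = parity (toℕ i)
  side (u i) = parity (toℕ i) ⁻¹

  side-next : ∀ x → side (next x) ≡ side x ⁻¹
  side-next (v i) = parity-⊕ i 2∤1
    where
    2∤1 : ¬ 2 ∣ 1
    2∤1 2∣1 with ∣1⇒≡1 2∣1
    ... | ()
  side-next (u i) = cong _⁻¹ (parity-⊕ i 2∤j)

  side-prev : ∀ x → side (prev x) ≡ side x ⁻¹
  side-prev x = sym (ℙ.⁻¹-selfInverse (trans (sym (side-next (prev x))) (cong side (next-prev x))))

  side-spoke : ∀ x → side (spoke x) ≡ side x ⁻¹
  side-spoke (v i) = refl
  side-spoke (u i) = sym (ℙ.⁻¹-involutive _)

  ℓ₂ : Labeling (GP m j)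
  ℓ₂ x = + bit (side x)

  ℓ₂-proper : Proper (GP m j) ℓ₂
  ℓ₂-proper = proper-by-neighbours ℓ₂ (flipped ∘ side-next) (flipped ∘ side-spoke)
    where
    flipped : ∀ {p q} → p ≡ q ⁻¹ → + bit p ≢ + bit q
    flipped {q = q} refl = bit-⁻¹ q ∘ ℤ.+-injective

  ℓ₂-closed : ∀ n → 2 ∣ n → ClosedColoringMod (GP m j) n ℓ₂
  ℓ₂-closed n 2∣n x = 2∣n⇒∤odd 2∣n
    (subst Odd (sym (closedSum≡ ℓ₂ x)) (odd-sum (side-next x) (side-prev x) (side-spoke x)))
    where
    odd-sum : ∀ {p a b c} → a ≡ p ⁻¹ → b ≡ p ⁻¹ → c ≡ p ⁻¹ →
      Odd (+ bit p ℤ.+ (+ bit a ℤ.+ (+ bit b ℤ.+ (+ bit c ℤ.+ 0ℤ))))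
    odd-sum {0ℙ} refl refl refl = + 1 , refl
    odd-sum {1ℙ} refl refl refl = 0ℤ , refl

  ℓ₂-order : order (GP m j) ℓ₂ ≡ 2
  ℓ₂-order =
    ≤-antisym (order≤length vertices-complete ℓ₂ (+ 0 ∷ + 1 ∷ []) (bit∈ ∘ side)) (order≥2 ℓ₂ ℓ₂-proper)
    where
    bit∈ : ∀ p → + bit p ∈ (+ 0 ∷ + 1 ∷ [])
    bit∈ 0ℙ = here refl
    bit∈ 1ℙ = there (here refl)

module SixLabeling (m j : ℕ) .{{_ : NonZero m}} (1≤j : 1 ℕ.≤ j) (2j<m : 2 ℕ.* j ℕ.< m) where
  open IntegerSums using (sumℤ)
  open Parities using (parity-even)
  open IntegerDivisibility
  open FiniteGraphs (GP m j)
  open Petersen m j 1≤j 2j<m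
  open Cyclic m using (_⊕_)
  open import Data.Integer as ℤ using (ℤ; +_; 0ℤ)
  import Data.Integer.Properties as ℤ
  open import Data.List using (map; upTo)
  open import Data.List.Membership.Propositional using (_∈_)
  open import Data.List.Membership.Propositional.Properties using (∈-map⁺; ∈-upTo⁺)
  open import Data.Nat using (ℕ; _+_; _*_; _≤_; _<_; s≤s; z≤n; parity)
  open import Data.Nat.Divisibility using (divides)
  open import Data.Nat.Properties using (*-comm; +-cancelˡ-≡; *-cancelˡ-≡; +-mono-≤; *-monoʳ-≤)
  import Data.Parity.Base as ℙ
  import Data.Parity.Properties as ℙ
  open import Data.Product using (_,_)
  open import Function using (_∘_)
  open import Relation.Binary.PropositionalEquality

  private instance
    j≢0 : NonZero j
    j≢0 = ℕ.>-nonZero 1≤j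

  module Outer = CirculantColoring m 1 3≤m
  module Inner = CirculantColoring m j 2j<m

  rim : PVtx m → ℕ
  rim (v _) = 1
  rim (u _) = 0

  color : PVtx m → ℕ
  color (v i) = Outer.color i
  color (u i) = Inner.color i

  ℓ₆ : Labeling (GP m j)
  ℓ₆ x = + rim x ℤ.+ + 2 ℤ.* + color x

  ℓ₆≡ : ∀ x → ℓ₆ x ≡ + (rim x + 2 * color x)
  ℓ₆≡ x = sym (trans (ℤ.pos-+ (rim x) _) (cong (ℤ._+_ (+ rim x)) (ℤ.pos-* 2 (color x))))

  private
    parity-rim : ∀ r a → parity (r + 2 * a) ≡ parity r
    parity-rim r a = trans (ℙ.+-homo-+ r (2 * a))
      (trans (cong (parity r ℙ.+_) (parity-even (divides a (*-comm 2 a)))) (ℙ.+-identityʳ _))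

  ℓ₆-proper : Proper (GP m j) ℓ₆
  ℓ₆-proper = proper-by-neighbours ℓ₆ next≢ spoke≢
    where
    unlabel : ∀ x y → ℓ₆ x ≡ ℓ₆ y → rim x + 2 * color x ≡ rim y + 2 * color y
    unlabel x y eq = ℤ.+-injective (trans (sym (ℓ₆≡ x)) (trans eq (ℓ₆≡ y)))
    next≢ : ∀ x → ℓ₆ (next x) ≢ ℓ₆ x
    next≢ (v i) eq = Outer.color-⊕ i (*-cancelˡ-≡ _ _ 2 (+-cancelˡ-≡ 1 _ _ (unlabel (v (i ⊕ 1)) (v i) eq)))
    next≢ (u i) eq = Inner.color-⊕ i (*-cancelˡ-≡ _ _ 2 (unlabel (u (i ⊕ j)) (u i) eq))
    same-rim-parity : ∀ x y → ℓ₆ x ≡ ℓ₆ y → parity (rim x) ≡ parity (rim y)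
    same-rim-parity x y eq =
      trans (sym (parity-rim (rim x) (color x))) (trans (cong parity (unlabel x y eq)) (parity-rim (rim y) (color y)))
    spoke≢ : ∀ x → ℓ₆ (spoke x) ≢ ℓ₆ x
    spoke≢ (v i) eq with same-rim-parity (u i) (v i) eq
    ... | ()
    spoke≢ (u i) eq with same-rim-parity (v i) (u i) eq
    ... | ()

  ℓ₆-closed : ∀ n → 2 ∣ n → ClosedColoringMod (GP m j) n ℓ₆
  ℓ₆-closed n 2∣n x = 2∣n⇒∤odd 2∣n (subst Odd (sym (closedSum-linear (+_ ∘ rim) (+_ ∘ color) (+ 2) x))
    (odd+even (closedSum (GP m j) (+_ ∘ color) x) (subst Odd (sym (closedSum≡ (+_ ∘ rim) x)) (odd-rims x))))
    where
    odd-rims : ∀ x → Odd (sumℤ (map (+_ ∘ rim) (closedNeighbourhood x)))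
    odd-rims (v i) = + 1 , refl
    odd-rims (u i) = 0ℤ , refl

  ℓ₆-properClosed : ∀ n → 2 ∣ n → ProperClosedColoring n ℓ₆
  ℓ₆-properClosed n 2∣n = ℓ₆-proper , ℓ₆-closed n 2∣n

  ℓ₆-order≤6 : order (GP m j) ℓ₆ ≤ 6
  ℓ₆-order≤6 = order≤length vertices-complete ℓ₆ (map +_ (upTo 6))
    λ x → subst (_∈ map +_ (upTo 6)) (sym (ℓ₆≡ x)) (∈-map⁺ +_ (∈-upTo⁺ (s≤s (label≤5 x))))
    where
    rim≤1 : ∀ x → rim x ≤ 1
    rim≤1 (v _) = s≤s z≤n
    rim≤1 (u _) = z≤n
    color≤2 : ∀ x → color x ≤ 2
    color≤2 (v i) = Outer.color≤2 i
    color≤2 (u i) = Inner.color≤2 i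
    label≤5 : ∀ x → rim x + 2 * color x ≤ 5
    label≤5 x = +-mono-≤ (rim≤1 x) (*-monoʳ-≤ 2 (color≤2 x))

open import Data.Nat using (ℕ; _≤_; _<_; _*_; NonZero)
open import Data.Nat.Divisibility using (_∣_)
open import Data.Product using (Σ; _×_)
open import Data.Sum using (_⊎_)
open import Relation.Nullary using (¬_)
open import Relation.Binary.PropositionalEquality using (_≡_; _≢_)

module ChromaticNumbers (m j : ℕ) .{{_ : NonZero m}} (1≤j : 1 ≤ j) (2j<m : 2 * j < m)
  (n : ℕ) .{{_ : NonZero n}} where
  open FiniteGraphs (GP m j)
  open Petersen m j 1≤j 2j<m
  open SixLabeling m j 1≤j 2j<m
  open import Data.Nat.Properties using (≤-trans)
  open import Data.Product using (_,_)
  open import Relation.Binary.PropositionalEquality using (trans; subst)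

  module χ = MinimalOrder (GP m j) vertices-complete n (Proper (GP m j)) (proper? vertices-complete) proper-relabel
  module χₙ = MinimalOrder (GP m j) vertices-complete n (ProperClosedColoring n)
    (properClosedColoring? vertices-complete n) properClosedColoring-relabel

  χₙ≡χ : ¬ n ∣ 4 → Σ ℕ (λ k → IsChromatic (GP m j) k × IsChiMod (GP m j) n k)
  χₙ≡χ n∤4 with χ.minimal-order ℓ₆-proper
  ... | k , (ℓ , proper , order≡k) , minimal =
    k , ((ℓ , proper , order≡k) , minimal) ,
    ((shifted ℓ , shifted-proper ℓ proper , shifted-closed ℓ n∤4 , trans (shifted-order ℓ) order≡k) ,
     λ ℓ′ proper′ _ → minimal ℓ′ proper′)
    where open AffineRelabeling m j 1≤j 2j<m n

  χₙ≡χ≡2 : 2 ∣ n → 2 ∣ m → ¬ 2 ∣ j → IsChromatic (GP m j) 2 × IsChiMod (GP m j) n 2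
  χₙ≡χ≡2 2∣n 2∣m 2∤j =
    ((ℓ₂ , ℓ₂-proper , ℓ₂-order) , order≥2) ,
    ((ℓ₂ , ℓ₂-proper , ℓ₂-closed n 2∣n , ℓ₂-order) , λ ℓ proper _ → order≥2 ℓ proper)
    where open BipartiteLabeling m j 1≤j 2j<m 2∣m 2∤j

  3≤χₙ≤6 : 2 ∣ n → ¬ (2 ∣ m × ¬ 2 ∣ j) → Σ ℕ (λ k → IsChiMod (GP m j) n k × 3 ≤ k × k ≤ 6)
  3≤χₙ≤6 2∣n not-bipartite with χₙ.minimal-order (ℓ₆-properClosed n 2∣n)
  ... | k , (ℓ , (proper , closed) , order≡k) , minimal =
    k , ((ℓ , proper , closed , order≡k) , λ ℓ′ proper′ closed′ → minimal ℓ′ (proper′ , closed′)) ,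
    subst (3 ≤_) order≡k (order≥3 ℓ not-bipartite proper) ,
    ≤-trans (minimal ℓ₆ (ℓ₆-properClosed n 2∣n)) ℓ₆-order≤6
    where open OddCycle m j 1≤j 2j<m

open import Data.Nat.Divisibility using (∣-refl; divides; ∣⇒≤; n∣m⇒m%n≡0)
open import Data.Nat.Properties using (≤-trans)
open import Data.Product using (_,_)
open import Data.Sum using (inj₁; inj₂)
open import Relation.Binary.PropositionalEquality using (refl)

n∤4 : ∀ {n} → 2 ≤ n → n ≢ 2 → n ≢ 4 → ¬ n ∣ 4
n∤4 {1} (ℕ.s≤s ()) _ _ _
n∤4 {2} _ n≢2 _ _ = n≢2 refl
n∤4 {3} _ _ _ 3∣4 with n∣m⇒m%n≡0 4 3 3∣4
... | ()
n∤4 {4} _ _ n≢4 _ = n≢4 refl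
n∤4 {ℕ.suc (ℕ.suc (ℕ.suc (ℕ.suc (ℕ.suc n))))} _ _ _ n∣4 with ∣⇒≤ n∣4
... | ℕ.s≤s (ℕ.s≤s (ℕ.s≤s (ℕ.s≤s ())))

2∣2⊎4 : ∀ {n} → n ≡ 2 ⊎ n ≡ 4 → 2 ∣ n
2∣2⊎4 (inj₁ refl) = ∣-refl
2∣2⊎4 (inj₂ refl) = divides 2 refl

theorem4p9 : (n m j : ℕ) .{{_ : NonZero m}} → 2 ≤ n → 3 ≤ m → 1 ≤ j → 2 * j < m →
    (n ≢ 2 → n ≢ 4 → Σ ℕ (λ k → IsChromatic (GP m j) k × IsChiMod (GP m j) n k))
    × ((n ≡ 2 ⊎ n ≡ 4) → 2 ∣ m → ¬ (2 ∣ j) →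
        IsChromatic (GP m j) 2 × IsChiMod (GP m j) n 2)
    × ((n ≡ 2 ⊎ n ≡ 4) → ¬ (2 ∣ m × ¬ (2 ∣ j)) →
        Σ ℕ (λ k → IsChiMod (GP m j) n k × 3 ≤ k × k ≤ 6))
theorem4p9 n m j 2≤n _ 1≤j 2j<m =
  (λ n≢2 n≢4 → χₙ≡χ (n∤4 2≤n n≢2 n≢4)) ,
  (λ n∈24 → χₙ≡χ≡2 (2∣2⊎4 n∈24)) ,
  (λ n∈24 → 3≤χₙ≤6 (2∣2⊎4 n∈24))
  where
  instance
    n≢0 : NonZero n
    n≢0 = ℕ.>-nonZero (≤-trans (ℕ.s≤s ℕ.z≤n) 2≤n)
  open ChromaticNumbers m j 1≤j 2j<m n
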